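{- For any graph $G$, the minimal dominating sets of $G$ and of its completion graph $G_{co}$ coincide: $\mathcal{D}(G)=\mathcal{D}(G_{co})$.
   Context: All graphs are finite, simple and undirected; $N_G[x]$ denotes the closed neighbourhood of $x$. $\mathcal{D}(G)$ is the set of inclusion-minimal dominating sets of $G$ (a dominating set is a vertex set $D$ such that every vertex is in $D$ or has a neighbour in $D$). A vertex $x$ is minimal with respect to neighbourhood inclusion if there is no vertex $y$ with $N_G[y]\subsetneq N_G[x]$. The set $IR(G)$ of irredundant vertices consists of the vertices minimal with respect to neighbourhood inclusion, where among minimal vertices having the same closed neighbourhood exactly one is taken to be irredundant; all other vertices are redundant, forming the set $RN(G)=V(G)\setminus IR(G)$. The completion graph $G_{co}$ has vertex set $V(G)$ and edge set $E(G)\cup\{xy\mid x,y\in RN(G),\ x\neq y\}$. -}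

module Defs where

open import Data.Nat using (ℕ)
open import Data.Fin using (Fin)
open import Data.Bool using (Bool; true; false; _∨_; _∧_; not)
open import Data.Product using (Σ; _×_; _,_; ∃-syntax)
open import Data.Sum using (_⊎_)
open import Relation.Nullary using (¬_)
open import Relation.Binary.PropositionalEquality using (_≡_; _≢_)

record Graph (n : ℕ) : Set where
  field
    adj   : Fin n → Fin n → Bool
    sym   : ∀ x y → adj x y ≡ adj y x
    irrefl : ∀ x → adj x x ≡ false
open Graph public

VSet : ℕ → Set
VSet n = Fin n → Bool

_∈ᵥ_ : ∀ {n} → Fin n → VSet n → Set
x ∈ᵥ S = S x ≡ true

_⊆ᵥ_ : ∀ {n} → VSet n → VSet n → Set
S ⊆ᵥ T = ∀ x → x ∈ᵥ S → x ∈ᵥ T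

N[_]_∋_ : ∀ {n} → Graph n → Fin n → Fin n → Set
N[ G ] x ∋ y = (x ≡ y) ⊎ (adj G x y ≡ true)

NbhdSub : ∀ {n} → Graph n → Fin n → Fin n → Set
NbhdSub G y x = ∀ z → N[ G ] y ∋ z → N[ G ] x ∋ z

NbhdStrictSub : ∀ {n} → Graph n → Fin n → Fin n → Set
NbhdStrictSub G y x = NbhdSub G y x × ¬ NbhdSub G x y

SameNbhd : ∀ {n} → Graph n → Fin n → Fin n → Set
SameNbhd G x y = NbhdSub G x y × NbhdSub G y x

IsMinimalVertex : ∀ {n} → Graph n → Fin n → Set
IsMinimalVertex G x = ¬ (Σ _ λ y → NbhdStrictSub G y x)

-- I is a valid choice of the irredundant set IR(G): it consists of minimal
-- vertices, and contains exactly one vertex from each class of minimal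
-- vertices sharing the same closed neighbourhood.
IsIRChoice : ∀ {n} → Graph n → VSet n → Set
IsIRChoice G I =
  (∀ x → x ∈ᵥ I → IsMinimalVertex G x) ×
  (∀ x → IsMinimalVertex G x → ∃[ y ] (y ∈ᵥ I × SameNbhd G x y)) ×
  (∀ x y → x ∈ᵥ I → y ∈ᵥ I → SameNbhd G x y → x ≡ y)

RN : ∀ {n} → VSet n → VSet n
RN I x = not (I x)

open import Data.Fin using (_≟_)
open import Relation.Nullary using (yes; no)
open import Relation.Nullary.Decidable using (⌊_⌋)
open import Data.Empty using (⊥-elim)
open import Relation.Binary.PropositionalEquality using (refl; cong₂)
open import Data.Bool.Properties using (∧-comm; ∧-zeroʳ; ∨-identityʳ)

_≠ᵇ_ : ∀ {n} → Fin n → Fin n → Bool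
x ≠ᵇ y = not ⌊ x ≟ y ⌋

private
  ≠ᵇ-sym : ∀ {n} (x y : Fin n) → x ≠ᵇ y ≡ y ≠ᵇ x
  ≠ᵇ-sym x y with x ≟ y | y ≟ x
  ... | yes _ | yes _ = refl
  ... | no _ | no _ = refl
  ... | yes refl | no p = ⊥-elim (p refl)
  ... | no p | yes refl = ⊥-elim (p refl)

  ≠ᵇ-irr : ∀ {n} (x : Fin n) → x ≠ᵇ x ≡ false
  ≠ᵇ-irr x with x ≟ x
  ... | yes _ = refl
  ... | no p = ⊥-elim (p refl)

IsDominating : ∀ {n} → Graph n → VSet n → Set
IsDominating G D = ∀ x → ∃[ y ] (y ∈ᵥ D × N[ G ] y ∋ x)

IsMinimalDominating : ∀ {n} → Graph n → VSet n → Set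
IsMinimalDominating G D =
  IsDominating G D × (∀ D' → D' ⊆ᵥ D → IsDominating G D' → D ⊆ᵥ D')

private
  co-irr : ∀ {n} (G : Graph n) (I : VSet n) x →
           adj G x x ∨ ((RN I x ∧ RN I x) ∧ (x ≠ᵇ x)) ≡ false
  co-irr G I x rewrite irrefl G x | ≠ᵇ-irr x = ∧-zeroʳ (RN I x ∧ RN I x)

-- completion graph G_co w.r.t. the irredundant set I (RN(G) = complement of I):
-- edges E(G) ∪ { xy | x,y ∈ RN(G), x ≠ y }
completion : ∀ {n} → (G : Graph n) → VSet n → Graph n
completion {n} G I = record
  { adj = λ x y → adj G x y ∨ ((RN I x ∧ RN I y) ∧ (x ≠ᵇ y))
  ; sym = λ x y → cong₂ _∨_ (sym G x y)
                    (cong₂ _∧_ (∧-comm (RN I x) (RN I y)) (≠ᵇ-sym x y))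
  ; irrefl = co-irr G I }

-- Adding edges can only help domination, so every dominating set of G dominates G_co.
-- Conversely, every vertex x lies above an irredundant vertex y, i.e. N_G[y] ⊆ N_G[x]:
-- descend along strict neighbourhood inclusion, which is well founded since the
-- neighbourhoods shrink, to a minimal vertex and replace it by its representative in
-- IR(G). The edges of G_co that are not in G join two redundant vertices, so whatever
-- dominates y in G_co is a G-neighbour of y, hence lies in N_G[x] and dominates x in G.
-- Thus G and G_co have the same dominating sets, hence the same minimal ones.
module Submission where

open import Defs
open import Data.Nat using (ℕ)
open import Data.Nat.Induction using (<-wellFounded)
open import Data.Bool using (true; not) renaming (_≟_ to _≟ᵇ_)
open import Data.Bool.Properties using (∧-zeroʳ; ∨-identityʳ)
open import Data.Empty using (⊥-elim)
open import Data.Fin using (Fin; _≟_)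
open import Data.Fin.Properties using (any?; all?; ¬∀⟶∃¬)
open import Data.Fin.Subset using (Subset; _∈_; _⊆_; _⊂_; ∣_∣)
open import Data.Fin.Subset.Properties using (p⊂q⇒∣p∣<∣q∣)
open import Data.Vec using (tabulate)
open import Data.Vec.Properties using (lookup∘tabulate; []=⇒lookup; lookup⇒[]=)
open import Data.Product using (_×_; _,_; proj₁; ∃-syntax)
open import Data.Sum using (inj₁; inj₂)
open import Function using (_∘_; id; const)
open import Induction.WellFounded using (WellFounded; Acc; acc; module Subrelation)
open import Level using (Level)
open import Relation.Binary.Core using (Rel)
import Relation.Binary.Construct.On as On
open import Relation.Binary.Construct.Closure.ReflexiveTransitive using (Star; ε; _◅_; _◅◅_; fold)
open import Relation.Nullary using (¬_; Dec; yes; no; does)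
open import Relation.Nullary.Decidable using (_⊎-dec_; _×-dec_; _→-dec_; ¬?; dec-true)
open import Relation.Binary.PropositionalEquality using (_≡_; refl; trans) renaming (sym to ≡-sym)

does≡true⇒ : ∀ {p} {P : Set p} (p? : Dec P) → does p? ≡ true → P
does≡true⇒ (yes p) _ = p

module _ {a ℓ : Level} {A : Set a} {_<_ : Rel A ℓ}
         (<-wf : WellFounded _<_) (∃<? : ∀ x → Dec (∃[ y ] y < x)) where

  ∃-minimal-below : ∀ x → ∃[ m ] (¬ (∃[ y ] y < m)) × Star _<_ m x
  ∃-minimal-below x = go (<-wf x)
    where
    go : ∀ {x} → Acc _<_ x → ∃[ m ] (¬ (∃[ y ] y < m)) × Star _<_ m x
    go {x} (acc rs) with ∃<? x
    ... | no x-minimal = x , x-minimal , ε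
    ... | yes (y , y<x) with go (rs y<x)
    ...   | m , m-minimal , m≤y = m , m-minimal , m≤y ◅◅ (y<x ◅ ε)

module _ {n : ℕ} (G : Graph n) where

  ∋-sym : ∀ {x y} → N[ G ] x ∋ y → N[ G ] y ∋ x
  ∋-sym (inj₁ x≡y) = inj₁ (≡-sym x≡y)
  ∋-sym {x} {y} (inj₂ xy) = inj₂ (trans (Graph.sym G y x) xy)

  NbhdSub-refl : ∀ {x} → NbhdSub G x x
  NbhdSub-refl _ = id

  NbhdSub-trans : ∀ {x y z} → NbhdSub G x y → NbhdSub G y z → NbhdSub G x z
  NbhdSub-trans x⊆y y⊆z v = y⊆z v ∘ x⊆y v

  ∋? : ∀ x y → Dec (N[ G ] x ∋ y)
  ∋? x y = (x ≟ y) ⊎-dec (adj G x y ≟ᵇ true)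

  NbhdSub? : ∀ y x → Dec (NbhdSub G y x)
  NbhdSub? y x = all? (λ z → ∋? y z →-dec ∋? x z)

  NbhdStrictSub? : ∀ y x → Dec (NbhdStrictSub G y x)
  NbhdStrictSub? y x = NbhdSub? y x ×-dec ¬? (NbhdSub? x y)

  N⟦_⟧ : Fin n → Subset n
  N⟦ x ⟧ = tabulate (does ∘ ∋? x)

  ∋⇒∈N⟦⟧ : ∀ {x z} → N[ G ] x ∋ z → z ∈ N⟦ x ⟧
  ∋⇒∈N⟦⟧ {x} {z} x∋z =
    lookup⇒[]= z N⟦ x ⟧ (trans (lookup∘tabulate _ z) (dec-true (∋? x z) x∋z))

  ∈N⟦⟧⇒∋ : ∀ {x z} → z ∈ N⟦ x ⟧ → N[ G ] x ∋ z
  ∈N⟦⟧⇒∋ {x} {z} z∈x =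
    does≡true⇒ (∋? x z) (trans (≡-sym (lookup∘tabulate _ z)) ([]=⇒lookup z∈x))

  ¬NbhdSub⇒∃ : ∀ {x y} → ¬ NbhdSub G x y → ∃[ z ] N[ G ] x ∋ z × ¬ N[ G ] y ∋ z
  ¬NbhdSub⇒∃ {x} {y} x⊈y with ¬∀⟶∃¬ n _ (λ z → ∋? x z →-dec ∋? y z) x⊈y
  ... | z , ¬[x∋z⇒y∋z] with ∋? x z
  ...   | yes x∋z = z , x∋z , ¬[x∋z⇒y∋z] ∘ const
  ...   | no x∌z = ⊥-elim (¬[x∋z⇒y∋z] (⊥-elim ∘ x∌z))

  NbhdSub⇒⊆ : ∀ {y x} → NbhdSub G y x → N⟦ y ⟧ ⊆ N⟦ x ⟧
  NbhdSub⇒⊆ y⊆x = ∋⇒∈N⟦⟧ ∘ y⊆x _ ∘ ∈N⟦⟧⇒∋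

  NbhdStrictSub⇒⊂ : ∀ {y x} → NbhdStrictSub G y x → N⟦ y ⟧ ⊂ N⟦ x ⟧
  NbhdStrictSub⇒⊂ (y⊆x , x⊈y) with ¬NbhdSub⇒∃ x⊈y
  ... | z , x∋z , y∌z = NbhdSub⇒⊆ y⊆x , z , ∋⇒∈N⟦⟧ x∋z , y∌z ∘ ∈N⟦⟧⇒∋

  NbhdStrictSub-wellFounded : WellFounded (NbhdStrictSub G)
  NbhdStrictSub-wellFounded = Subrelation.wellFounded (p⊂q⇒∣p∣<∣q∣ ∘ NbhdStrictSub⇒⊂)
    (On.wellFounded (∣_∣ ∘ N⟦_⟧) <-wellFounded)

  ∃-minimalVertex-below : ∀ x → ∃[ m ] IsMinimalVertex G m × NbhdSub G m x
  ∃-minimalVertex-below x with ∃-minimal-below NbhdStrictSub-wellFounded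
                                 (λ x → any? (λ y → NbhdStrictSub? y x)) x
  ... | m , m-minimal , m≤x =
    m , m-minimal , fold (NbhdSub G) (NbhdSub-trans ∘ proj₁) NbhdSub-refl m≤x

  ∃-irredundant-below : ∀ {I} → IsIRChoice G I → ∀ x → ∃[ y ] y ∈ᵥ I × NbhdSub G y x
  ∃-irredundant-below (_ , represented , _) x with ∃-minimalVertex-below x
  ... | m , m-minimal , m⊆x with represented m m-minimal
  ...   | y , y∈I , (_ , y⊆m) = y , y∈I , NbhdSub-trans y⊆m m⊆x

module _ {n : ℕ} (G : Graph n) (I : VSet n) where

  completion-⊇ : ∀ {x y} → adj G x y ≡ true → adj (completion G I) x y ≡ true
  completion-⊇ xy rewrite xy = refl

  completion-adj-∈ : ∀ {x y} → y ∈ᵥ I → adj (completion G I) x y ≡ adj G x y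
  completion-adj-∈ {x} {y} y∈I rewrite y∈I | ∧-zeroʳ (not (I x)) = ∨-identityʳ (adj G x y)

  completion-∋-∈ : ∀ {x y} → y ∈ᵥ I → N[ completion G I ] x ∋ y → N[ G ] x ∋ y
  completion-∋-∈ y∈I (inj₁ x≡y) = inj₁ x≡y
  completion-∋-∈ y∈I (inj₂ xy) = inj₂ (trans (≡-sym (completion-adj-∈ y∈I)) xy)

IsDominating-⊆ : ∀ {n} (G H : Graph n) → (∀ {x y} → adj G x y ≡ true → adj H x y ≡ true) →
                 ∀ {D} → IsDominating G D → IsDominating H D
IsDominating-⊆ G H G⊆H dom x with dom x
... | y , y∈D , inj₁ y≡x = y , y∈D , inj₁ y≡x
... | y , y∈D , inj₂ yx = y , y∈D , inj₂ (G⊆H yx)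

completion-dominating⇒dominating : ∀ {n} (G : Graph n) {I} → IsIRChoice G I →
                                   ∀ {D} → IsDominating (completion G I) D → IsDominating G D
completion-dominating⇒dominating G {I} irc dom x with ∃-irredundant-below G irc x
... | y , y∈I , y⊆x with dom y
...   | d , d∈D , d∋y =
  d , d∈D , ∋-sym G (y⊆x d (∋-sym G (completion-∋-∈ G I y∈I d∋y)))

IsMinimalDominating-transfer : ∀ {n} (G H : Graph n) →
  (∀ {D} → IsDominating G D → IsDominating H D) →
  (∀ {D} → IsDominating H D → IsDominating G D) →
  ∀ D → IsMinimalDominating G D → IsMinimalDominating H D
IsMinimalDominating-transfer G H G⇒H H⇒G D (dom , minimal) =
  G⇒H dom , λ D' D'⊆D dom' → minimal D' D'⊆D (H⇒G dom')

proposition5p1 : ∀ (n : ℕ) (G : Graph n) (I : VSet n) → IsIRChoice G I →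
    ∀ (D : VSet n) →
      (IsMinimalDominating G D → IsMinimalDominating (completion G I) D) ×
      (IsMinimalDominating (completion G I) D → IsMinimalDominating G D)
proposition5p1 n G I irc D =
  IsMinimalDominating-transfer G (completion G I) G⇒co co⇒G D ,
  IsMinimalDominating-transfer (completion G I) G co⇒G G⇒co D
  where
  G⇒co : ∀ {D} → IsDominating G D → IsDominating (completion G I) D
  G⇒co = IsDominating-⊆ G (completion G I) (completion-⊇ G I)

  co⇒G : ∀ {D} → IsDominating (completion G I) D → IsDominating G D
  co⇒G = completion-dominating⇒dominating G irc
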